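{- Let $n\ge1$ and $\mathcal{M}=\{1^{k_1},\ldots,n^{k_n}\}$ with all $k_i\ge1$. There exists a bijection $\phi:\mathcal{T}_{\mathcal{M}}\to\overline{\mathcal{Q}}_{\mathcal{M}}$ such that for every $T\in\mathcal{T}_{\mathcal{M}}$, $$cdes(T)=des(\phi(T)),\quad first(T)=first(\phi(T)),\quad last(T)=last(\phi(T)).$$
   Context: $\mathcal{M}$ is the multiset in which $i$ occurs exactly $k_i$ times. A permutation of $\mathcal{M}$ is a word with each $i$ occurring exactly $k_i$ times; it is quasi-Stirling if there are no indices $i<j<k<\ell$ with $\pi_i=\pi_k$ and $\pi_j=\pi_\ell$. $\overline{\mathcal{Q}}_{\mathcal{M}}$ is the set of quasi-Stirling permutations of $\mathcal{M}$. For a word $\pi=\pi_1\cdots\pi_N$, $des(\pi)=|\{i:1\le i\le N-1,\ \pi_i>\pi_{i+1}\}|+1$; $first(\pi)=\pi_1$, $last(\pi)=\pi_N$. An ordered tree is a rooted tree in which the children of each vertex are linearly ordered (left to right); the level of a vertex is its distance from the root. $\mathcal{T}_{\mathcal{M}}$ is the set of ordered trees whose vertices are labeled by the elements of the multiset $\{0\}\cup\mathcal{M}$ (each label used exactly as often as its multiplicity), such that: the root is labeled $0$; and every vertex at odd level with label $i$ has exactly $k_i-1$ children, all labeled $i$. (Trees are considered up to label-preserving isomorphism of ordered trees.) For a vertex $u$ with children $v_1,\ldots,v_\ell$ from left to right, $cdes(u)$ is the number of cyclic descents of the label sequence $u v_1\cdots v_\ell$, i.e. the number of positions $j$ with $w_j>w_{j+1}$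 in $w=uv_1\cdots v_\ell$, with the convention that the entry after the last is the first (so a leaf has $cdes(u)=0$). $cdes(T)=\sum_{u}cdes(u)$ over all vertices $u$ of $T$, except that $cdes(T)=1$ if $T$ has only one vertex. $first(T)$ (resp. $last(T)$) is the label of the leftmost (resp. rightmost) child of the root, with $first(T)=+\infty$, $last(T)=-\infty$ if $T$ has one vertex. -}

module Defs where

open import Data.Nat using (ℕ; zero; suc; _+_; _∸_; _≤_; _<_; _<ᵇ_; _≡ᵇ_)
open import Data.Bool using (Bool; true; false; if_then_else_)
open import Data.List using (List; []; _∷_; _++_; length)
open import Data.List.Relation.Unary.All using (All)
open import Data.Product using (_×_; Σ; ∃)
open import Data.Unit using (⊤)
open import Relation.Binary.PropositionalEquality using (_≡_; _≢_)
open import Relation.Nullary using (¬_)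

-- Multisets M = {1^{k 1}, ..., n^{k n}} are given by n : ℕ and
-- k : ℕ → ℕ; only the values k 1, ..., k n are ever used.

count : ℕ → List ℕ → ℕ
count x [] = 0
count x (y ∷ ys) = if x ≡ᵇ y then suc (count x ys) else count x ys

-- entry at position i (0-based), default 0 (only used for i < length)
at : List ℕ → ℕ → ℕ
at [] _ = 0
at (x ∷ xs) zero = x
at (x ∷ xs) (suc i) = at xs i

IsPermM : ℕ → (ℕ → ℕ) → List ℕ → Set
IsPermM n k π =
  All (λ x → 1 ≤ x × x ≤ n) π ×
  (∀ i → 1 ≤ i → i ≤ n → count i π ≡ k i)

IsQuasiStirling : List ℕ → Set
IsQuasiStirling π =
  ¬ (Σ ℕ λ i → Σ ℕ λ j → Σ ℕ λ k → Σ ℕ λ l →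
       i < j × j < k × k < l × l < length π ×
       at π i ≡ at π k × at π j ≡ at π l × at π i ≢ at π j)

InQ : ℕ → (ℕ → ℕ) → List ℕ → Set
InQ n k π = IsPermM n k π × IsQuasiStirling π

descents : List ℕ → ℕ
descents [] = 0
descents (x ∷ []) = 0
descents (x ∷ y ∷ ys) = (if y <ᵇ x then 1 else 0) + descents (y ∷ ys)

des : List ℕ → ℕ
des π = descents π + 1

data ℕ±∞ : Set where
  -∞  : ℕ±∞
  fin : ℕ → ℕ±∞
  +∞  : ℕ±∞

firstW : List ℕ → ℕ±∞
firstW [] = +∞        -- convention, never used (words are nonempty)
firstW (x ∷ _) = fin x

lastW : List ℕ → ℕ±∞
lastW [] = -∞         -- convention, never used
lastW (x ∷ []) = fin x
lastW (_ ∷ y ∷ ys) = lastW (y ∷ ys)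

-- Ordered labeled trees (label-preserving isomorphism of ordered trees
-- is exactly equality of this inductive representation)

data Tree : Set where
  node : ℕ → List Tree → Tree

label : Tree → ℕ
label (node a _) = a

mutual
  labels : Tree → List ℕ
  labels (node a cs) = a ∷ labelsF cs

  labelsF : List Tree → List ℕ
  labelsF [] = []
  labelsF (t ∷ ts) = labels t ++ labelsF ts

childLabels : List Tree → List ℕ
childLabels [] = []
childLabels (t ∷ ts) = label t ∷ childLabels ts

mutual
  EvenOK : (ℕ → ℕ) → Tree → Set
  EvenOK k (node a cs) = OddOKs k cs

  OddOKs : (ℕ → ℕ) → List Tree → Set
  OddOKs k [] = ⊤
  OddOKs k (t ∷ ts) = OddOK k t × OddOKs k ts

  OddOK : (ℕ → ℕ) → Tree → Set
  OddOK k (node i cs) =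
    length cs ≡ k i ∸ 1 × All (λ c → label c ≡ i) cs × EvenOKs k cs

  EvenOKs : (ℕ → ℕ) → List Tree → Set
  EvenOKs k [] = ⊤
  EvenOKs k (t ∷ ts) = EvenOK k t × EvenOKs k ts

InT : ℕ → (ℕ → ℕ) → Tree → Set
InT n k T =
  label T ≡ 0 ×
  All (λ x → x ≤ n) (labels T) ×
  count 0 (labels T) ≡ 1 ×
  (∀ i → 1 ≤ i → i ≤ n → count i (labels T) ≡ k i) ×
  EvenOK k T

-- cyclic descents of the word a v_1 ... v_l (entry after last is first)
cdesV : ℕ → List ℕ → ℕ
cdesV a vs = descents ((a ∷ vs) ++ (a ∷ []))

mutual
  cdesSum : Tree → ℕ
  cdesSum (node a cs) = cdesV a (childLabels cs) + cdesSumF cs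

  cdesSumF : List Tree → ℕ
  cdesSumF [] = 0
  cdesSumF (t ∷ ts) = cdesSum t + cdesSumF ts

cdesT : Tree → ℕ
cdesT (node a []) = 1
cdesT (node a (c ∷ cs)) = cdesSum (node a (c ∷ cs))

firstT : Tree → ℕ±∞
firstT (node _ []) = +∞
firstT (node _ (c ∷ _)) = fin (label c)

lastT : Tree → ℕ±∞
-- lastW [] = -∞ matches the one-vertex convention
lastT (node _ cs) = lastW (childLabels cs)

-- An odd vertex a whose children carry the forests F₁, …, Fₘ is written as
-- a W(F₁) a W(F₂) a … W(Fₘ) a, and a forest as the concatenation of the words of
-- its trees.  Since an odd vertex labelled a has kₐ − 1 children, the word of its
-- subtree contains all kₐ copies of a and, inductively, of every letter occurring in
-- it; so the words of disjoint subtrees share no letter, which excludes any pattern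
-- x y x y.  Conversely, in a quasi-Stirling word a w the later occurrences of a cut
-- off the words of the children of a one by one, and what follows the last a is the
-- word of the remaining trees; these pieces avoid a and pairwise share no letter, so
-- decoding them recursively inverts the encoding.  The descents of a W(F) a are
-- those inside F plus those of a c₁ … cᵣ a, where c₁, …, cᵣ label the roots of F,
-- i.e. the cyclic descents of the even vertex carrying F.  Odd vertices have no
-- cyclic descent, their children repeating their label, and the wrap-around descent
-- of the root to 0 is the + 1 in des.

module Submission where

open import Defs
open import Data.Nat using (ℕ; zero; suc; _+_; _∸_; _≤_; _<_; z≤n; s≤s; _≡ᵇ_; _<ᵇ_; _≟_)
open import Data.Nat.Properties
open import Data.Nat.Tactic.RingSolver using (solve-∀)
open import Data.Bool using (true; false; T; if_then_else_)
open import Data.List using (List; []; _∷_; _++_; length; map; take; drop)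
open import Data.List.Properties using (++-assoc; length-map; length-++-≤ˡ; length-++-≤ʳ)
open import Data.List.Membership.Propositional using (_∈_; _∉_)
open import Data.List.Membership.Propositional.Properties using (∈-++⁻; ∈-++⁺ˡ; ∈-++⁺ʳ)
open import Data.List.Membership.DecPropositional _≟_ using (_∈?_)
open import Data.List.Relation.Unary.All as All using (All; []; _∷_)
open import Data.List.Relation.Unary.All.Properties using (map⁺)
open import Data.List.Relation.Unary.Any as Any using (here; there)
open import Data.List.Relation.Binary.Disjoint.Propositional using (Disjoint)
open import Data.List.Relation.Binary.Sublist.Propositional
  using (_⊆_; []; _∷_; _∷ʳ_; ⊆-refl; ⊆-trans; minimum; lookup; from∈)
open import Data.List.Relation.Binary.Sublist.Propositional.Properties
  using (++⁺; ++⁺ˡ; ++⁺ʳ; length-mono-≤)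
import Data.List.Relation.Binary.Permutation.Propositional as ↭
open ↭ using (_↭_; ↭-sym)
open import Data.List.Relation.Binary.Permutation.Propositional.Properties
  using (All-resp-↭; shift) renaming (++⁺ to ↭-++⁺)
open import Data.Product using (Σ; ∃; ∃₂; _×_; _,_; proj₁; proj₂)
open import Data.Sum using (_⊎_; inj₁; inj₂)
open import Data.Unit using (⊤; tt)
open import Data.Empty using (⊥-elim)
open import Relation.Nullary using (¬_; yes; no)
open import Relation.Binary.PropositionalEquality
  using (_≡_; _≢_; refl; sym; trans; cong; cong₂; subst; module ≡-Reasoning)
open import Function using (_∘_; flip)

-- Letter counts

count-here : ∀ x w → count x (x ∷ w) ≡ suc (count x w)
count-here x w with x ≡ᵇ x | ≡⇒≡ᵇ x x refl
... | true | _ = refl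

count-there : ∀ {x y} w → x ≢ y → count x (y ∷ w) ≡ count x w
count-there {x} {y} w x≢y with x ≡ᵇ y in eq
... | false = refl
... | true = ⊥-elim (x≢y (≡ᵇ⇒≡ x y (subst T (sym eq) _)))

count-++ : ∀ x u v → count x (u ++ v) ≡ count x u + count x v
count-++ x [] v = refl
count-++ x (y ∷ u) v with x ≡ᵇ y
... | true = cong suc (count-++ x u v)
... | false = count-++ x u v

count-∷-≤ : ∀ x y w → count x w ≤ count x (y ∷ w)
count-∷-≤ x y w with x ≡ᵇ y
... | true = n≤1+n (count x w)
... | false = ≤-refl

∈⇒count-pos : ∀ {x w} → x ∈ w → 1 ≤ count x w
∈⇒count-pos {x} {_ ∷ w} (here refl) rewrite count-here x w = s≤s z≤n
∈⇒count-pos {x} {y ∷ w} (there x∈w) = ≤-trans (∈⇒count-pos x∈w) (count-∷-≤ x y w)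

∉⇒count≡0 : ∀ {x} w → x ∉ w → count x w ≡ 0
∉⇒count≡0 [] x∉w = refl
∉⇒count≡0 {x} (y ∷ w) x∉w with x ≟ y
... | yes refl = ⊥-elim (x∉w (here refl))
... | no x≢y = trans (count-there w x≢y) (∉⇒count≡0 w (x∉w ∘ there))

count-mono-⊆ : ∀ x {u w} → u ⊆ w → count x u ≤ count x w
count-mono-⊆ x [] = z≤n
count-mono-⊆ x {w = _ ∷ w} (y ∷ʳ u⊆w) = ≤-trans (count-mono-⊆ x u⊆w) (count-∷-≤ x y w)
count-mono-⊆ x (_∷_ {x = y} refl u⊆w) with x ≡ᵇ y
... | true = s≤s (count-mono-⊆ x u⊆w)
... | false = count-mono-⊆ x u⊆w

count-resp-↭ : ∀ x {u v} → u ↭ v → count x u ≡ count x v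
count-resp-↭ x ↭.refl = refl
count-resp-↭ x (↭.prep y u↭v) with x ≡ᵇ y
... | true = cong suc (count-resp-↭ x u↭v)
... | false = count-resp-↭ x u↭v
count-resp-↭ x (↭.swap y z u↭v) with x ≡ᵇ y | x ≡ᵇ z
... | true | true = cong (suc ∘ suc) (count-resp-↭ x u↭v)
... | true | false = cong suc (count-resp-↭ x u↭v)
... | false | true = cong suc (count-resp-↭ x u↭v)
... | false | false = count-resp-↭ x u↭v
count-resp-↭ x (↭.trans u↭v v↭w) = trans (count-resp-↭ x u↭v) (count-resp-↭ x v↭w)

-- Crossings

Crossing : List ℕ → Set
Crossing w = ∃₂ λ x y → x ≢ y × x ∷ y ∷ x ∷ y ∷ [] ⊆ w

crossing-length : ∀ {w} → Crossing w → 4 ≤ length w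
crossing-length (_ , _ , _ , s) = length-mono-≤ s

crossing-mono : ∀ {u w} → u ⊆ w → Crossing u → Crossing w
crossing-mono u⊆w (x , y , x≢y , s) = x , y , x≢y , ⊆-trans s u⊆w

∷-⊆-drop : ∀ w {m i xs} → i < length w → m ≤ i → xs ⊆ drop (suc i) w →
           at w i ∷ xs ⊆ drop m w
∷-⊆-drop (y ∷ w) {zero} {zero} _ _ s = refl ∷ s
∷-⊆-drop (y ∷ w) {zero} {suc i} (s≤s i<n) _ s = y ∷ʳ ∷-⊆-drop w i<n z≤n s
∷-⊆-drop (y ∷ w) {suc m} {suc i} (s≤s i<n) (s≤s m≤i) s = ∷-⊆-drop w i<n m≤i s

∷-⊆-drop⁻ : ∀ m w {x xs} → x ∷ xs ⊆ drop m w →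
            ∃ λ i → m ≤ i × i < length w × at w i ≡ x × xs ⊆ drop (suc i) w
∷-⊆-drop⁻ zero (y ∷ w) (refl ∷ s) = 0 , z≤n , s≤s z≤n , refl , s
∷-⊆-drop⁻ zero (y ∷ w) (.y ∷ʳ s) with ∷-⊆-drop⁻ zero w s
... | i , _ , i<n , wᵢ≡x , s′ = suc i , z≤n , s≤s i<n , wᵢ≡x , s′
∷-⊆-drop⁻ (suc m) (y ∷ w) s with ∷-⊆-drop⁻ m w s
... | i , m≤i , i<n , wᵢ≡x , s′ = suc i , s≤s m≤i , s≤s i<n , wᵢ≡x , s′

quasiStirling⇒¬crossing : ∀ π → IsQuasiStirling π → ¬ Crossing π
quasiStirling⇒¬crossing π qs (x , y , x≢y , s)
  with i , _ , _ , πᵢ≡x , s₁ ← ∷-⊆-drop⁻ 0 π s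
  with j , i<j , _ , πⱼ≡y , s₂ ← ∷-⊆-drop⁻ (suc i) π s₁
  with k , j<k , _ , πₖ≡x , s₃ ← ∷-⊆-drop⁻ (suc j) π s₂
  with l , k<l , l<n , πₗ≡y , _ ← ∷-⊆-drop⁻ (suc k) π s₃ =
  qs (i , j , k , l , i<j , j<k , k<l , l<n ,
      trans πᵢ≡x (sym πₖ≡x) , trans πⱼ≡y (sym πₗ≡y) ,
      λ πᵢ≡πⱼ → x≢y (trans (sym πᵢ≡x) (trans πᵢ≡πⱼ πⱼ≡y)))

¬crossing⇒quasiStirling : ∀ π → ¬ Crossing π → IsQuasiStirling π
¬crossing⇒quasiStirling π noCrossing
  (i , j , k , l , i<j , j<k , k<l , l<n , πᵢ≡πₖ , πⱼ≡πₗ , πᵢ≢πⱼ) =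
  noCrossing (at π i , at π j , πᵢ≢πⱼ , subst (_⊆ π) letters sub)
  where
  k<n : k < length π
  k<n = <-trans k<l l<n
  j<n : j < length π
  j<n = <-trans j<k k<n
  sub : at π i ∷ at π j ∷ at π k ∷ at π l ∷ [] ⊆ π
  sub = ∷-⊆-drop π (<-trans i<j j<n) z≤n
          (∷-⊆-drop π j<n i<j (∷-⊆-drop π k<n j<k (∷-⊆-drop π l<n k<l (minimum _))))
  letters : at π i ∷ at π j ∷ at π k ∷ at π l ∷ [] ≡ at π i ∷ at π j ∷ at π i ∷ at π j ∷ []
  letters = cong₂ (λ z₁ z₂ → at π i ∷ at π j ∷ z₁ ∷ z₂ ∷ []) (sym πᵢ≡πₖ) (sym πⱼ≡πₗ)

⊆-++-split : ∀ {A : Set} (xs us : List A) {vs : List A} → xs ⊆ us ++ vs →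
             ∃ λ i → take i xs ⊆ us × drop i xs ⊆ vs
⊆-++-split xs [] s = 0 , minimum _ , s
⊆-++-split xs (u ∷ us) (.u ∷ʳ s) with i , p , q ← ⊆-++-split xs us s = i , u ∷ʳ p , q
⊆-++-split (x ∷ xs) (u ∷ us) (refl ∷ s) with i , p , q ← ⊆-++-split xs us s = suc i , refl ∷ p , q

crossing-++⁻ : ∀ u {v : List ℕ} → Disjoint u v → Crossing (u ++ v) → Crossing u ⊎ Crossing v
crossing-++⁻ u {v} u#v (x , y , x≢y , s) with ⊆-++-split (x ∷ y ∷ x ∷ y ∷ []) u {v} s
... | 0 , _ , q = inj₂ (x , y , x≢y , q)
... | 1 , p , q = ⊥-elim (u#v (lookup p (here refl) , lookup q (there (here refl))))
... | 2 , p , q = ⊥-elim (u#v (lookup p (here refl) , lookup q (here refl)))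
... | 3 , p , q = ⊥-elim (u#v (lookup p (there (here refl)) , lookup q (here refl)))
... | 4 , p , _ = inj₁ (x , y , x≢y , p)
... | suc (suc (suc (suc (suc _)))) , p , _ = inj₁ (x , y , x≢y , p)

crossing-∷-++⁻ : ∀ a u {v : List ℕ} → Disjoint u (a ∷ v) → Crossing (a ∷ u ++ a ∷ v) →
                 Crossing u ⊎ Crossing (a ∷ v)
crossing-∷-++⁻ a u u#av (x , y , x≢y , .a ∷ʳ s) = crossing-++⁻ u u#av (x , y , x≢y , s)
crossing-∷-++⁻ a u {v} u#av (.a , y , a≢y , refl ∷ s) with ⊆-++-split (y ∷ a ∷ y ∷ []) u {a ∷ v} s
... | 0 , _ , .a ∷ʳ q = inj₂ (a , y , a≢y , refl ∷ q)
... | 0 , _ , refl ∷ _ = ⊥-elim (a≢y refl)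
... | 1 , p , q = ⊥-elim (u#av (lookup p (here refl) , lookup q (there (here refl))))
... | suc (suc _) , p , _ = ⊥-elim (u#av (lookup p (there (here refl)) , here refl))

-- Budgets and saturated words

record Budget (k : ℕ → ℕ) (w : List ℕ) : Set where
  constructor budget
  field
    count≤ : ∀ c → count c w ≤ k c

budget-⊆ : ∀ {k u w} → u ⊆ w → Budget k w → Budget k u
budget-⊆ u⊆w (budget count≤) = budget λ c → ≤-trans (count-mono-⊆ c u⊆w) (count≤ c)

budget-++⁻ˡ : ∀ {k} u {v} → Budget k (u ++ v) → Budget k u
budget-++⁻ˡ u {v} = budget-⊆ (++⁺ʳ v ⊆-refl)

budget-++⁻ʳ : ∀ {k} u {v} → Budget k (u ++ v) → Budget k v
budget-++⁻ʳ u = budget-⊆ (++⁺ˡ u ⊆-refl)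

budget-∷⁻ : ∀ {k a w} → Budget k (a ∷ w) → Budget k w
budget-∷⁻ {a = a} = budget-⊆ (a ∷ʳ ⊆-refl)

Saturated : (ℕ → ℕ) → List ℕ → Set
Saturated k w = ∀ {c} → c ∈ w → k c ≤ count c w

saturated-++ : ∀ {k} u {v} → Saturated k u → Saturated k v → Saturated k (u ++ v)
saturated-++ u {v} sat-u sat-v {c} c∈uv with ∈-++⁻ u c∈uv
... | inj₁ c∈u = ≤-trans (sat-u c∈u) (count-mono-⊆ c {u} (++⁺ʳ v ⊆-refl))
... | inj₂ c∈v = ≤-trans (sat-v c∈v) (count-mono-⊆ c {v} (++⁺ˡ u ⊆-refl))

saturated-disjoint : ∀ {k} u {v} → Budget k (u ++ v) → Saturated k u → Disjoint u v
saturated-disjoint {k} u {v} (budget count≤) sat {c} (c∈u , c∈v) = 1+n≰n (begin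
  1 + k c               ≤⟨ +-mono-≤ (∈⇒count-pos c∈v) (sat c∈u) ⟩
  count c v + count c u ≡⟨ +-comm (count c v) (count c u) ⟩
  count c u + count c v ≡⟨ count-++ c u v ⟨
  count c (u ++ v)      ≤⟨ count≤ c ⟩
  k c                   ∎)
  where open ≤-Reasoning

-- From trees to words

children : Tree → List Tree
children (node _ ts) = ts

mutual
  oddWord : Tree → List ℕ
  oddWord (node a es) = a ∷ childrenWord a es

  childrenWord : ℕ → List Tree → List ℕ
  childrenWord a [] = []
  childrenWord a (node _ cs ∷ es) = forestWord cs ++ a ∷ childrenWord a es

  forestWord : List Tree → List ℕ
  forestWord [] = []
  forestWord (t ∷ ts) = oddWord t ++ forestWord ts

encode : Tree → List ℕ
encode T = forestWord (children T)

childrenWord-count : ∀ a es → length es ≤ count a (childrenWord a es)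
childrenWord-count a [] = z≤n
childrenWord-count a (node _ cs ∷ es) = begin
  suc (length es)                                  ≤⟨ s≤s (childrenWord-count a es) ⟩
  suc (count a (childrenWord a es))                ≡⟨ count-here a (childrenWord a es) ⟨
  count a (a ∷ childrenWord a es)                  ≤⟨ count-mono-⊆ a (++⁺ˡ (forestWord cs) ⊆-refl) ⟩
  count a (forestWord cs ++ a ∷ childrenWord a es) ∎
  where open ≤-Reasoning

mutual
  oddWord-saturated : ∀ {k} t → OddOK k t → Saturated k (oddWord t)
  oddWord-saturated {k} (node a es) (arity , _ , ok-es) {c} c∈ with c ≟ a
  ... | yes refl = begin
    k a                               ≤⟨ m≤n+m∸n (k a) 1 ⟩
    suc (k a ∸ 1)                     ≡⟨ cong suc arity ⟨
    suc (length es)                   ≤⟨ s≤s (childrenWord-count a es) ⟩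
    suc (count a (childrenWord a es)) ≡⟨ count-here a (childrenWord a es) ⟨
    count a (a ∷ childrenWord a es)   ∎
    where open ≤-Reasoning
  ... | no c≢a = subst (k c ≤_) (sym (count-there (childrenWord a es) c≢a))
                   (childrenWord-saturated a es ok-es c≢a (Any.tail c≢a c∈))

  childrenWord-saturated : ∀ {k} a es → EvenOKs k es →
                           ∀ {c} → c ≢ a → c ∈ childrenWord a es →
                           k c ≤ count c (childrenWord a es)
  childrenWord-saturated {k} a (node _ cs ∷ es) (ok-cs , ok-es) {c} c≢a c∈
    with ∈-++⁻ (forestWord cs) c∈
  ... | inj₁ c∈cs = ≤-trans (forestWord-saturated cs ok-cs c∈cs)
                            (count-mono-⊆ c {forestWord cs} (++⁺ʳ (a ∷ childrenWord a es) ⊆-refl))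
  ... | inj₂ c∈rest = ≤-trans
    (subst (k c ≤_) (sym (count-there (childrenWord a es) c≢a))
      (childrenWord-saturated a es ok-es c≢a (Any.tail c≢a c∈rest)))
    (count-mono-⊆ c {a ∷ childrenWord a es} (++⁺ˡ (forestWord cs) ⊆-refl))

  forestWord-saturated : ∀ {k} ts → OddOKs k ts → Saturated k (forestWord ts)
  forestWord-saturated (t ∷ ts) (ok-t , ok-ts) =
    saturated-++ (oddWord t) (oddWord-saturated t ok-t) (forestWord-saturated ts ok-ts)

mutual
  forestWord-¬crossing : ∀ {k} ts → OddOKs k ts → Budget k (forestWord ts) →
                         ¬ Crossing (forestWord ts)
  forestWord-¬crossing [] _ _ c with () ← crossing-length c
  forestWord-¬crossing (t@(node a es) ∷ ts) (ok-t@(_ , _ , ok-es) , ok-ts) within c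
    with crossing-++⁻ (oddWord t) (saturated-disjoint (oddWord t) within (oddWord-saturated t ok-t)) c
  ... | inj₁ c′ = childrenWord-¬crossing a es ok-es (budget-++⁻ˡ (oddWord t) within) c′
  ... | inj₂ c′ = forestWord-¬crossing ts ok-ts (budget-++⁻ʳ (oddWord t) within) c′

  childrenWord-¬crossing : ∀ {k} a es → EvenOKs k es → Budget k (a ∷ childrenWord a es) →
                           ¬ Crossing (a ∷ childrenWord a es)
  childrenWord-¬crossing a [] _ _ c with s≤s () ← crossing-length c
  childrenWord-¬crossing a (node _ cs ∷ es) (ok-cs , ok-es) within c
    with crossing-∷-++⁻ a (forestWord cs)
           (saturated-disjoint (forestWord cs) (budget-∷⁻ within) (forestWord-saturated cs ok-cs)) c
  ... | inj₁ c′ = forestWord-¬crossing cs ok-cs (budget-++⁻ˡ (forestWord cs) (budget-∷⁻ within)) c′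
  ... | inj₂ c′ = childrenWord-¬crossing a es ok-es (budget-++⁻ʳ (forestWord cs) (budget-∷⁻ within)) c′

-- Splitting a word at a letter

∉-∷⁺ : ∀ {a y : ℕ} {w} → a ≢ y → a ∉ w → a ∉ y ∷ w
∉-∷⁺ a≢y a∉w (here a≡y) = a≢y a≡y
∉-∷⁺ a≢y a∉w (there a∈w) = a∉w a∈w

joinOn : ℕ → List (List ℕ) → List ℕ → List ℕ
joinOn a [] rest = rest
joinOn a (s ∷ ss) rest = s ++ a ∷ joinOn a ss rest

extendFirst : ℕ → List (List ℕ) × List ℕ → List (List ℕ) × List ℕ
extendFirst y ([] , rest) = [] , y ∷ rest
extendFirst y (s ∷ ss , rest) = (y ∷ s) ∷ ss , rest

splitOn : ℕ → List ℕ → List (List ℕ) × List ℕ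
splitOn a [] = [] , []
splitOn a (y ∷ w) with a ≟ y
... | yes _ = [] ∷ proj₁ (splitOn a w) , proj₂ (splitOn a w)
... | no _ = extendFirst y (splitOn a w)

record IsSplitting (a : ℕ) (w : List ℕ) (ss : List (List ℕ)) (rest : List ℕ) : Set where
  constructor splitting
  field
    rejoins : w ≡ joinOn a ss rest
    segments-∌ : All (a ∉_) ss
    rest-∌ : a ∉ rest

splitOn-sound : ∀ a w → IsSplitting a w (proj₁ (splitOn a w)) (proj₂ (splitOn a w))
splitOn-sound a [] = splitting refl [] λ ()
splitOn-sound a (y ∷ w) with a ≟ y | splitOn-sound a w
... | yes refl | splitting w≡ a∉ss a∉rest = splitting (cong (a ∷_) w≡) ((λ ()) ∷ a∉ss) a∉rest
... | no a≢y | sp = extendFirst-sound (splitOn a w) sp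
  where
  extendFirst-sound : ∀ p → IsSplitting a w (proj₁ p) (proj₂ p) →
                      IsSplitting a (y ∷ w) (proj₁ (extendFirst y p)) (proj₂ (extendFirst y p))
  extendFirst-sound ([] , rest) (splitting w≡ _ a∉rest) =
    splitting (cong (y ∷_) w≡) [] (∉-∷⁺ a≢y a∉rest)
  extendFirst-sound (s ∷ ss , rest) (splitting w≡ (a∉s ∷ a∉ss) a∉rest) =
    splitting (cong (y ∷_) w≡) (∉-∷⁺ a≢y a∉s ∷ a∉ss) a∉rest

splitOn-∌ : ∀ a rest → a ∉ rest → splitOn a rest ≡ ([] , rest)
splitOn-∌ a [] _ = refl
splitOn-∌ a (y ∷ rest) a∉ with a ≟ y
... | yes refl = ⊥-elim (a∉ (here refl))
... | no _ = cong (extendFirst y) (splitOn-∌ a rest (a∉ ∘ there))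

splitOn-segment : ∀ a s {J ss rest} → a ∉ s → splitOn a J ≡ (ss , rest) →
                  splitOn a (s ++ a ∷ J) ≡ (s ∷ ss , rest)
splitOn-segment a [] _ J-splits with a ≟ a
... | yes _ rewrite J-splits = refl
... | no a≢a = ⊥-elim (a≢a refl)
splitOn-segment a (y ∷ s) a∉ J-splits with a ≟ y
... | yes refl = ⊥-elim (a∉ (here refl))
... | no _ = cong (extendFirst y) (splitOn-segment a s (a∉ ∘ there) J-splits)

splitOn-joinOn : ∀ a ss rest → All (a ∉_) ss → a ∉ rest →
                 splitOn a (joinOn a ss rest) ≡ (ss , rest)
splitOn-joinOn a [] rest [] a∉rest = splitOn-∌ a rest a∉rest
splitOn-joinOn a (s ∷ ss) rest (a∉s ∷ a∉ss) a∉rest =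
  splitOn-segment a s a∉s (splitOn-joinOn a ss rest a∉ss a∉rest)

count-joinOn : ∀ a ss rest → All (a ∉_) ss → a ∉ rest →
               count a (joinOn a ss rest) ≡ length ss
count-joinOn a [] rest [] a∉rest = ∉⇒count≡0 rest a∉rest
count-joinOn a (s ∷ ss) rest (a∉s ∷ a∉ss) a∉rest = begin
  count a (s ++ a ∷ joinOn a ss rest)
    ≡⟨ count-++ a s _ ⟩
  count a s + count a (a ∷ joinOn a ss rest)
    ≡⟨ cong₂ _+_ (∉⇒count≡0 s a∉s) (count-here a (joinOn a ss rest)) ⟩
  suc (count a (joinOn a ss rest))
    ≡⟨ cong suc (count-joinOn a ss rest a∉ss a∉rest) ⟩
  suc (length ss)
    ∎
  where open ≡-Reasoning

-- From words to trees

-- The fuel f only has to bound the length of the word being decoded.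
mutual
  decodeForest : ℕ → List ℕ → List Tree
  decodeForest zero _ = []
  decodeForest (suc f) [] = []
  decodeForest (suc f) (a ∷ w) = decodeSplit f a (splitOn a w)

  decodeSplit : ℕ → ℕ → List (List ℕ) × List ℕ → List Tree
  decodeSplit f a (ss , rest) = node a (decodeSegments f a ss) ∷ decodeForest f rest

  decodeSegments : ℕ → ℕ → List (List ℕ) → List Tree
  decodeSegments f a = map (λ s → node a (decodeForest f s))

decode : List ℕ → Tree
decode w = node 0 (decodeForest (length w) w)

forestWord-decodeForest : ∀ f w → length w ≤ f → forestWord (decodeForest f w) ≡ w
forestWord-decodeForest zero [] _ = refl
forestWord-decodeForest (suc f) [] _ = refl
forestWord-decodeForest (suc f) (a ∷ w) (s≤s w≤f) = cong (a ∷_) (begin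
    childrenWord a (decodeSegments f a ss) ++ forestWord (decodeForest f rest)
  ≡⟨ decodes ss rest (subst (λ v → length v ≤ f) rejoins w≤f) ⟩
    joinOn a ss rest
  ≡⟨ rejoins ⟨
    w
  ∎)
  where
  open ≡-Reasoning
  open IsSplitting (splitOn-sound a w)
  ss : List (List ℕ)
  ss = proj₁ (splitOn a w)
  rest : List ℕ
  rest = proj₂ (splitOn a w)
  decodes : ∀ pieces r → length (joinOn a pieces r) ≤ f →
            childrenWord a (decodeSegments f a pieces) ++ forestWord (decodeForest f r) ≡ joinOn a pieces r
  decodes [] r r≤f = forestWord-decodeForest f r r≤f
  decodes (s ∷ pieces) r ≤f = begin
    (forestWord (decodeForest f s) ++ a ∷ childrenWord a (decodeSegments f a pieces)) ++ tail
      ≡⟨ ++-assoc (forestWord (decodeForest f s)) _ tail ⟩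
    forestWord (decodeForest f s) ++ a ∷ (childrenWord a (decodeSegments f a pieces) ++ tail)
      ≡⟨ cong₂ (λ u v → u ++ a ∷ v)
           (forestWord-decodeForest f s (≤-trans (length-++-≤ˡ s) ≤f))
           (decodes pieces r (≤-trans (≤-trans (n≤1+n _) (length-++-≤ʳ (a ∷ joinOn a pieces r) {s})) ≤f)) ⟩
    s ++ a ∷ joinOn a pieces r
      ∎
    where
    tail : List ℕ
    tail = forestWord (decodeForest f r)

segments : List Tree → List (List ℕ)
segments = map (forestWord ∘ children)

childrenWord-++ : ∀ a es X → childrenWord a es ++ X ≡ joinOn a (segments es) X
childrenWord-++ a [] X = refl
childrenWord-++ a (node _ cs ∷ es) X =
  trans (++-assoc (forestWord cs) _ X)
        (cong (λ v → forestWord cs ++ a ∷ v) (childrenWord-++ a es X))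

childrenWord-segments-∌ : ∀ {k} a es → EvenOKs k es → Budget k (childrenWord a es) →
                          All (a ∉_) (segments es)
childrenWord-segments-∌ a [] _ _ = []
childrenWord-segments-∌ a (node _ cs ∷ es) (ok-cs , ok-es) within =
  (λ a∈cs → saturated-disjoint (forestWord cs) within (forestWord-saturated cs ok-cs)
                                (a∈cs , here refl))
  ∷ childrenWord-segments-∌ a es ok-es (budget-∷⁻ (budget-++⁻ʳ (forestWord cs) within))

mutual
  decodeForest-forestWord : ∀ {k} f ts → OddOKs k ts → Budget k (forestWord ts) →
                            length (forestWord ts) ≤ f → decodeForest f (forestWord ts) ≡ ts
  decodeForest-forestWord zero [] _ _ _ = refl
  decodeForest-forestWord (suc f) [] _ _ _ = refl
  decodeForest-forestWord zero (node _ _ ∷ _) _ _ ()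
  decodeForest-forestWord {k} (suc f) (t@(node a es) ∷ ts)
                          (ok-t@(_ , labelled , ok-es) , ok-ts) within (s≤s ≤f) =
    begin
      decodeSplit f a (splitOn a (childrenWord a es ++ forestWord ts))
    ≡⟨ cong (decodeSplit f a) splits ⟩
      node a (decodeSegments f a (segments es)) ∷ decodeForest f (forestWord ts)
    ≡⟨ cong₂ (λ es′ ts′ → node a es′ ∷ ts′)
         (decodeSegments-segments f a es labelled ok-es within-es
            (≤-trans (length-++-≤ˡ (childrenWord a es)) ≤f))
         (decodeForest-forestWord f ts ok-ts within-ts
            (≤-trans (length-++-≤ʳ (forestWord ts) {childrenWord a es}) ≤f)) ⟩
      node a es ∷ ts
    ∎
    where
    open ≡-Reasoning
    within-es : Budget k (childrenWord a es)
    within-es = budget-++⁻ˡ (childrenWord a es) (budget-∷⁻ within)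
    within-ts : Budget k (forestWord ts)
    within-ts = budget-++⁻ʳ (oddWord t) within
    a∉ts : a ∉ forestWord ts
    a∉ts a∈ts = saturated-disjoint (oddWord t) within (oddWord-saturated t ok-t) (here refl , a∈ts)
    splits : splitOn a (childrenWord a es ++ forestWord ts) ≡ (segments es , forestWord ts)
    splits = trans (cong (splitOn a) (childrenWord-++ a es (forestWord ts)))
                   (splitOn-joinOn a (segments es) (forestWord ts)
                      (childrenWord-segments-∌ a es ok-es within-es) a∉ts)

  decodeSegments-segments : ∀ {k} f a es → All (λ e → label e ≡ a) es → EvenOKs k es →
                            Budget k (childrenWord a es) → length (childrenWord a es) ≤ f →
                            decodeSegments f a (segments es) ≡ es
  decodeSegments-segments f a [] _ _ _ _ = refl
  decodeSegments-segments f a (node _ cs ∷ es) (refl ∷ labelled) (ok-cs , ok-es) within ≤f =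
    cong₂ (λ cs′ es′ → node a cs′ ∷ es′)
      (decodeForest-forestWord f cs ok-cs (budget-++⁻ˡ (forestWord cs) within)
         (≤-trans (length-++-≤ˡ (forestWord cs)) ≤f))
      (decodeSegments-segments f a es labelled ok-es
         (budget-∷⁻ (budget-++⁻ʳ (forestWord cs) within))
         (≤-trans (≤-trans (n≤1+n _) (length-++-≤ʳ (a ∷ childrenWord a es) {forestWord cs})) ≤f))

Exact : (ℕ → ℕ) → List ℕ → Set
Exact k w = ∀ {b} → b ∈ w → count b w ≡ k b

ExactExcept : ℕ → (ℕ → ℕ) → List ℕ → Set
ExactExcept a k w = ∀ {b} → b ≢ a → b ∈ w → count b w ≡ k b

exact-∷⁻ : ∀ {k a w} → Exact k (a ∷ w) → ExactExcept a k w
exact-∷⁻ {w = w} exact b≢a b∈w = trans (sym (count-there w b≢a)) (exact (there b∈w))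

exactExcept-∌ : ∀ {k a w} → a ∉ w → ExactExcept a k w → Exact k w
exactExcept-∌ a∉w exact b∈w = exact (λ { refl → a∉w b∈w }) b∈w

exact⇒budget : ∀ {k w} → Exact k w → Budget k w
exact⇒budget {k} {w} exact = budget count≤
  where
  count≤ : ∀ c → count c w ≤ k c
  count≤ c with c ∈? w
  ... | yes c∈w = ≤-reflexive (exact c∈w)
  ... | no c∉w = subst (_≤ k c) (sym (∉⇒count≡0 w c∉w)) z≤n

shared⇒crossing : ∀ a s J {b} → b ≢ a → b ∈ s → b ∈ J → Crossing (a ∷ s ++ a ∷ J)
shared⇒crossing a s J b≢a b∈s b∈J =
  a , _ , b≢a ∘ sym , refl ∷ ++⁺ (from∈ b∈s) (refl ∷ from∈ b∈J)

mutual
  decodeForest-valid : ∀ {k} f w → ¬ Crossing w → Exact k w → OddOKs k (decodeForest f w)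
  decodeForest-valid zero _ _ _ = tt
  decodeForest-valid (suc f) [] _ _ = tt
  decodeForest-valid {k} (suc f) (a ∷ w) noCrossing exact =
    (arity , map⁺ (All.universal (λ _ → refl) ss) , proj₁ pieces) , proj₂ pieces
    where
    open IsSplitting (splitOn-sound a w)
    ss : List (List ℕ)
    ss = proj₁ (splitOn a w)
    rest : List ℕ
    rest = proj₂ (splitOn a w)
    arity : length (decodeSegments f a ss) ≡ k a ∸ 1
    arity = begin
      length (decodeSegments f a ss) ≡⟨ length-map _ ss ⟩
      length ss                      ≡⟨ count-joinOn a ss rest segments-∌ rest-∌ ⟨
      count a (joinOn a ss rest)     ≡⟨ cong (count a) rejoins ⟨
      count a w                      ≡⟨ cong (_∸ 1) (trans (sym (count-here a w)) (exact (here refl))) ⟩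
      k a ∸ 1                        ∎
      where open ≡-Reasoning
    pieces : EvenOKs k (decodeSegments f a ss) × OddOKs k (decodeForest f rest)
    pieces = segments-valid f a ss rest segments-∌ rest-∌
               (subst (λ v → ¬ Crossing (a ∷ v)) rejoins noCrossing)
               (subst (ExactExcept a k) rejoins (exact-∷⁻ exact))

  segments-valid : ∀ {k} f a ss rest → All (a ∉_) ss → a ∉ rest →
                   ¬ Crossing (a ∷ joinOn a ss rest) → ExactExcept a k (joinOn a ss rest) →
                   EvenOKs k (decodeSegments f a ss) × OddOKs k (decodeForest f rest)
  segments-valid f a [] rest [] a∉rest noCrossing exact =
    tt , decodeForest-valid f rest (noCrossing ∘ crossing-mono (a ∷ʳ ⊆-refl))
                                   (exactExcept-∌ a∉rest exact)
  segments-valid {k} f a (s ∷ ss) rest (a∉s ∷ a∉ss) a∉rest noCrossing exact =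
    (decodeForest-valid f s (noCrossing ∘ crossing-mono (a ∷ʳ ++⁺ʳ (a ∷ after) ⊆-refl)) exact-s ,
     proj₁ pieces) ,
    proj₂ pieces
    where
    after : List ℕ
    after = joinOn a ss rest
    separated : ∀ {b} → b ≢ a → b ∈ s → b ∉ after
    separated b≢a b∈s b∈after = noCrossing (shared⇒crossing a s after b≢a b∈s b∈after)
    count-split : ∀ {b} → b ≢ a → count b (s ++ a ∷ after) ≡ count b s + count b after
    count-split {b} b≢a =
      trans (count-++ b s (a ∷ after)) (cong (count b s +_) (count-there after b≢a))
    exact-s : Exact k s
    exact-s {b} b∈s = begin
      count b s                 ≡⟨ +-identityʳ (count b s) ⟨
      count b s + 0             ≡⟨ cong (count b s +_) (∉⇒count≡0 after (separated b≢a b∈s)) ⟨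
      count b s + count b after ≡⟨ count-split b≢a ⟨
      count b (s ++ a ∷ after)  ≡⟨ exact b≢a (∈-++⁺ˡ b∈s) ⟩
      k b                       ∎
      where
      open ≡-Reasoning
      b≢a : b ≢ a
      b≢a refl = a∉s b∈s
    exact-after : ExactExcept a k after
    exact-after {b} b≢a b∈after = begin
      count b after             ≡⟨ cong (_+ count b after) (∉⇒count≡0 s (flip (separated b≢a) b∈after)) ⟨
      count b s + count b after ≡⟨ count-split b≢a ⟨
      count b (s ++ a ∷ after)  ≡⟨ exact b≢a (∈-++⁺ʳ s (there b∈after)) ⟩
      k b                       ∎
      where open ≡-Reasoning
    pieces : EvenOKs k (decodeSegments f a ss) × OddOKs k (decodeForest f rest)
    pieces = segments-valid f a ss rest a∉ss a∉rest
               (noCrossing ∘ crossing-mono (refl ∷ ++⁺ˡ s (a ∷ʳ ⊆-refl))) exact-after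

-- Labels and descents

-- The label half of the odd-level condition, without the arity half.
mutual
  WellLabelledForest : List Tree → Set
  WellLabelledForest [] = ⊤
  WellLabelledForest (node a es ∷ ts) = WellLabelledChildren a es × WellLabelledForest ts

  WellLabelledChildren : ℕ → List Tree → Set
  WellLabelledChildren a [] = ⊤
  WellLabelledChildren a (node b cs ∷ es) =
    b ≡ a × WellLabelledForest cs × WellLabelledChildren a es

mutual
  oddOKs⇒wellLabelled : ∀ {k} ts → OddOKs k ts → WellLabelledForest ts
  oddOKs⇒wellLabelled [] _ = tt
  oddOKs⇒wellLabelled (node a es ∷ ts) ((_ , labelled , ok-es) , ok-ts) =
    evenOKs⇒wellLabelled a es labelled ok-es , oddOKs⇒wellLabelled ts ok-ts

  evenOKs⇒wellLabelled : ∀ {k} a es → All (λ e → label e ≡ a) es → EvenOKs k es →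
                         WellLabelledChildren a es
  evenOKs⇒wellLabelled a [] _ _ = tt
  evenOKs⇒wellLabelled a (node _ cs ∷ es) (b≡a ∷ labelled) (ok-cs , ok-es) =
    b≡a , oddOKs⇒wellLabelled cs ok-cs , evenOKs⇒wellLabelled a es labelled ok-es

mutual
  labelsF-↭-forestWord : ∀ ts → WellLabelledForest ts → labelsF ts ↭ forestWord ts
  labelsF-↭-forestWord [] _ = ↭.refl
  labelsF-↭-forestWord (node a es ∷ ts) (wl-es , wl-ts) =
    ↭-++⁺ (↭.prep a (labelsF-↭-childrenWord a es wl-es)) (labelsF-↭-forestWord ts wl-ts)

  labelsF-↭-childrenWord : ∀ a es → WellLabelledChildren a es → labelsF es ↭ childrenWord a es
  labelsF-↭-childrenWord a [] _ = ↭.refl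
  labelsF-↭-childrenWord a (node _ cs ∷ es) (refl , wl-cs , wl-es) =
    ↭.trans (↭.prep a (↭-++⁺ (labelsF-↭-forestWord cs wl-cs)
                             (labelsF-↭-childrenWord a es wl-es)))
            (↭-sym (shift a (forestWord cs) (childrenWord a es)))

lastFrom : ℕ → List ℕ → ℕ
lastFrom x [] = x
lastFrom x (y ∷ w) = lastFrom y w

lastFrom-++ : ∀ x u v → lastFrom x (u ++ v) ≡ lastFrom (lastFrom x u) v
lastFrom-++ x [] v = refl
lastFrom-++ x (y ∷ u) v = lastFrom-++ y u v

lastFrom-All : ∀ {P : ℕ → Set} x w → All P (x ∷ w) → P (lastFrom x w)
lastFrom-All x [] (px ∷ _) = px
lastFrom-All x (y ∷ w) (_ ∷ pw) = lastFrom-All y w pw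

lastW-∷ : ∀ y w → lastW (y ∷ w) ≡ fin (lastFrom y w)
lastW-∷ y [] = refl
lastW-∷ y (z ∷ w) = lastW-∷ z w

descent : ℕ → ℕ → ℕ
descent x y = if y <ᵇ x then 1 else 0

descent-refl : ∀ x → descent x x ≡ 0
descent-refl zero = refl
descent-refl (suc x) = descent-refl x

descents-++ : ∀ x u v →
              descents (x ∷ u ++ v) ≡ descents (x ∷ u) + descents (lastFrom x u ∷ v)
descents-++ x [] v = refl
descents-++ x (y ∷ u) v =
  trans (cong (descent x y +_) (descents-++ y u v)) (sym (+-assoc (descent x y) (descents (y ∷ u)) _))

cdesV-constant : ∀ a es → WellLabelledChildren a es → cdesV a (childLabels es) ≡ 0
cdesV-constant a [] _ = cong (_+ 0) (descent-refl a)
cdesV-constant a (node _ _ ∷ es) (refl , _ , wl-es) =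
  cong₂ _+_ (descent-refl a) (cdesV-constant a es wl-es)

lastFrom-childrenWord : ∀ a es → lastFrom a (childrenWord a es) ≡ a
lastFrom-childrenWord a [] = refl
lastFrom-childrenWord a (node _ cs ∷ es) =
  trans (lastFrom-++ a (forestWord cs) (a ∷ childrenWord a es)) (lastFrom-childrenWord a es)

lastFrom-forestWord : ∀ x ts → lastFrom x (forestWord ts) ≡ lastFrom x (childLabels ts)
lastFrom-forestWord x [] = refl
lastFrom-forestWord x (node a es ∷ ts) = begin
  lastFrom a (childrenWord a es ++ forestWord ts)
    ≡⟨ lastFrom-++ a (childrenWord a es) (forestWord ts) ⟩
  lastFrom (lastFrom a (childrenWord a es)) (forestWord ts)
    ≡⟨ cong (λ z → lastFrom z (forestWord ts)) (lastFrom-childrenWord a es) ⟩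
  lastFrom a (forestWord ts)
    ≡⟨ lastFrom-forestWord a ts ⟩
  lastFrom a (childLabels ts)
    ∎
  where open ≡-Reasoning

mutual
  descents-forestWord : ∀ x ts → WellLabelledForest ts →
                        descents (x ∷ forestWord ts) ≡ descents (x ∷ childLabels ts) + cdesSumF ts
  descents-forestWord x [] _ = refl
  descents-forestWord x (node a es ∷ ts) (wl-es , wl-ts) = begin
    descent x a + descents (a ∷ childrenWord a es ++ forestWord ts)
      ≡⟨ cong (descent x a +_) (descents-++ a (childrenWord a es) (forestWord ts)) ⟩
    descent x a +
      (descents (a ∷ childrenWord a es) + descents (lastFrom a (childrenWord a es) ∷ forestWord ts))
      ≡⟨ cong₂ (λ d z → descent x a + (d + descents (z ∷ forestWord ts)))
           (descents-childrenWord a es wl-es) (lastFrom-childrenWord a es) ⟩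
    descent x a + (cdesSumF es + descents (a ∷ forestWord ts))
      ≡⟨ cong (λ d → descent x a + (cdesSumF es + d)) (descents-forestWord a ts wl-ts) ⟩
    descent x a + (cdesSumF es + (descents (a ∷ childLabels ts) + cdesSumF ts))
      ≡⟨ rearrange (descent x a) (cdesSumF es) (descents (a ∷ childLabels ts)) (cdesSumF ts) ⟩
    (descent x a + descents (a ∷ childLabels ts)) + ((0 + cdesSumF es) + cdesSumF ts)
      ≡⟨ cong (λ z → (descent x a + descents (a ∷ childLabels ts)) +
                     ((z + cdesSumF es) + cdesSumF ts))
           (cdesV-constant a es wl-es) ⟨
    (descent x a + descents (a ∷ childLabels ts)) +
      ((cdesV a (childLabels es) + cdesSumF es) + cdesSumF ts)
      ∎
    where
    open ≡-Reasoning
    rearrange : ∀ d e c f → d + (e + (c + f)) ≡ (d + c) + ((0 + e) + f)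
    rearrange = solve-∀

  descents-childrenWord : ∀ a es → WellLabelledChildren a es →
                          descents (a ∷ childrenWord a es) ≡ cdesSumF es
  descents-childrenWord a [] _ = refl
  descents-childrenWord a (node _ cs ∷ es) (refl , wl-cs , wl-es) = begin
    descents (a ∷ forestWord cs ++ a ∷ childrenWord a es)
      ≡⟨ descents-++ a (forestWord cs) (a ∷ childrenWord a es) ⟩
    descents (a ∷ forestWord cs) + (descent ℓ a + descents (a ∷ childrenWord a es))
      ≡⟨ cong₂ (λ d e → d + (descent ℓ a + e))
           (descents-forestWord a cs wl-cs) (descents-childrenWord a es wl-es) ⟩
    (descents (a ∷ childLabels cs) + cdesSumF cs) + (descent ℓ a + cdesSumF es)
      ≡⟨ rearrange (descents (a ∷ childLabels cs)) (cdesSumF cs) (descent ℓ a) (cdesSumF es) ⟩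
    ((descents (a ∷ childLabels cs) + (descent ℓ a + 0)) + cdesSumF cs) + cdesSumF es
      ≡⟨ cong (λ z → ((descents (a ∷ childLabels cs) + (descent z a + 0)) + cdesSumF cs)
                     + cdesSumF es)
           (lastFrom-forestWord a cs) ⟩
    ((descents (a ∷ childLabels cs) + descents (ℓ′ ∷ a ∷ [])) + cdesSumF cs) + cdesSumF es
      ≡⟨ cong (λ z → (z + cdesSumF cs) + cdesSumF es) (descents-++ a (childLabels cs) (a ∷ [])) ⟨
    (cdesV a (childLabels cs) + cdesSumF cs) + cdesSumF es
      ∎
    where
    open ≡-Reasoning
    ℓ ℓ′ : ℕ
    ℓ = lastFrom a (forestWord cs)
    ℓ′ = lastFrom a (childLabels cs)
    rearrange : ∀ d c e f → (d + c) + (e + f) ≡ ((d + (e + 0)) + c) + f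
    rearrange = solve-∀

descents-to-0 : ∀ {x} → 1 ≤ x → descents (x ∷ 0 ∷ []) ≡ 1
descents-to-0 (s≤s _) = refl

forestWord-statistics : ∀ ts → WellLabelledForest ts → All (1 ≤_) (forestWord ts) →
  cdesT (node 0 ts) ≡ des (forestWord ts) ×
  firstT (node 0 ts) ≡ firstW (forestWord ts) ×
  lastT (node 0 ts) ≡ lastW (forestWord ts)
forestWord-statistics [] _ _ = refl , refl , refl
forestWord-statistics ts@(node b es ∷ us) wl positive = cdes≡des , refl , last≡last
  where
  open ≡-Reasoning
  ℓ : ℕ
  ℓ = lastFrom 0 (childLabels ts)
  ℓ-positive : 1 ≤ ℓ
  ℓ-positive = subst (1 ≤_) (lastFrom-forestWord 0 ts) (lastFrom-All b _ positive)
  cdes≡des : cdesV 0 (childLabels ts) + cdesSumF ts ≡ descents (forestWord ts) + 1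
  cdes≡des = begin
    descents (0 ∷ childLabels ts ++ 0 ∷ []) + cdesSumF ts
      ≡⟨ cong (_+ cdesSumF ts) (descents-++ 0 (childLabels ts) (0 ∷ [])) ⟩
    (descents (0 ∷ childLabels ts) + descents (ℓ ∷ 0 ∷ [])) + cdesSumF ts
      ≡⟨ cong (λ z → (descents (0 ∷ childLabels ts) + z) + cdesSumF ts)
              (descents-to-0 ℓ-positive) ⟩
    (descents (0 ∷ childLabels ts) + 1) + cdesSumF ts
      ≡⟨ +-comm-last (descents (0 ∷ childLabels ts)) (cdesSumF ts) ⟩
    (descents (0 ∷ childLabels ts) + cdesSumF ts) + 1
      ≡⟨ cong (_+ 1) (descents-forestWord 0 ts wl) ⟨
    descents (0 ∷ forestWord ts) + 1
      ∎
    where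
    +-comm-last : ∀ d c → (d + 1) + c ≡ (d + c) + 1
    +-comm-last = solve-∀
  last≡last : lastW (childLabels ts) ≡ lastW (forestWord ts)
  last≡last = begin
    lastW (b ∷ childLabels us)                            ≡⟨ lastW-∷ b (childLabels us) ⟩
    fin (lastFrom b (childLabels us))                     ≡⟨ cong fin (lastFrom-forestWord 0 ts) ⟨
    fin (lastFrom b (childrenWord b es ++ forestWord us)) ≡⟨ lastW-∷ b (childrenWord b es ++ forestWord us) ⟨
    lastW (forestWord ts)                                 ∎

-- The bijection

encode-decode : ∀ π → encode (decode π) ≡ π
encode-decode π = forestWord-decodeForest (length π) π ≤-refl

module _ {n : ℕ} {k : ℕ → ℕ} where

  InT-letters : ∀ ts → InT n k (node 0 ts) → All (λ x → 1 ≤ x × x ≤ n) (forestWord ts)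
  InT-letters ts (_ , _ ∷ labels≤n , count₀ , _ , ok) =
    All.tabulate λ x∈ →
      n≢0⇒n>0 (λ { refl → 0∉ x∈ }) , All.lookup (All-resp-↭ σ labels≤n) x∈
    where
    σ : labelsF ts ↭ forestWord ts
    σ = labelsF-↭-forestWord ts (oddOKs⇒wellLabelled ts ok)
    0∉ : 0 ∉ forestWord ts
    0∉ 0∈ with () ← subst (1 ≤_) (trans (sym (count-resp-↭ 0 σ)) (suc-injective count₀))
                                  (∈⇒count-pos 0∈)

  InT-count : ∀ ts → InT n k (node 0 ts) →
              ∀ i → 1 ≤ i → i ≤ n → count i (forestWord ts) ≡ k i
  InT-count ts (_ , _ , _ , counts , ok) i 1≤i i≤n = begin
    count i (forestWord ts)
      ≡⟨ count-resp-↭ i (labelsF-↭-forestWord ts (oddOKs⇒wellLabelled ts ok)) ⟨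
    count i (labelsF ts)
      ≡⟨ count-there (labelsF ts) (n>0⇒n≢0 1≤i) ⟨
    count i (0 ∷ labelsF ts)
      ≡⟨ counts i 1≤i i≤n ⟩
    k i
      ∎
    where open ≡-Reasoning

  InT-exact : ∀ ts → InT n k (node 0 ts) → Exact k (forestWord ts)
  InT-exact ts v x∈ =
    let (1≤x , x≤n) = All.lookup (InT-letters ts v) x∈ in InT-count ts v _ 1≤x x≤n

  encode-InQ : ∀ T → InT n k T → InQ n k (encode T)
  encode-InQ (node _ ts) v@(refl , _ , _ , _ , ok) =
    (InT-letters ts v , InT-count ts v) ,
    ¬crossing⇒quasiStirling (forestWord ts)
      (forestWord-¬crossing ts ok (exact⇒budget (InT-exact ts v)))

  decode-encode : ∀ T → InT n k T → decode (encode T) ≡ T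
  decode-encode (node _ ts) v@(refl , _ , _ , _ , ok) =
    cong (node 0) (decodeForest-forestWord (length (forestWord ts)) ts ok
                     (exact⇒budget (InT-exact ts v)) ≤-refl)

  encode-injective : ∀ T T′ → InT n k T → InT n k T′ → encode T ≡ encode T′ → T ≡ T′
  encode-injective T T′ v v′ eq = begin
    T                  ≡⟨ decode-encode T v ⟨
    decode (encode T)  ≡⟨ cong decode eq ⟩
    decode (encode T′) ≡⟨ decode-encode T′ v′ ⟩
    T′                 ∎
    where open ≡-Reasoning

  decode-InT : ∀ π → InQ n k π → InT n k (decode π)
  decode-InT π ((letters , counts) , qs) =
    refl , z≤n ∷ All-resp-↭ (↭-sym σ) (All.map proj₂ letters) , cong suc count₀ , counts′ , ok
    where
    ts : List Tree
    ts = decodeForest (length π) π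
    ok : OddOKs k ts
    ok = decodeForest-valid (length π) π (quasiStirling⇒¬crossing π qs)
           λ x∈ → let (1≤x , x≤n) = All.lookup letters x∈ in counts _ 1≤x x≤n
    σ : labelsF ts ↭ π
    σ = subst (labelsF ts ↭_) (encode-decode π)
              (labelsF-↭-forestWord ts (oddOKs⇒wellLabelled ts ok))
    count₀ : count 0 (labelsF ts) ≡ 0
    count₀ = trans (count-resp-↭ 0 σ)
                   (∉⇒count≡0 π λ 0∈ → n>0⇒n≢0 (proj₁ (All.lookup letters 0∈)) refl)
    counts′ : ∀ i → 1 ≤ i → i ≤ n → count i (0 ∷ labelsF ts) ≡ k i
    counts′ i 1≤i i≤n =
      trans (count-there (labelsF ts) (n>0⇒n≢0 1≤i)) (trans (count-resp-↭ i σ) (counts i 1≤i i≤n))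

  encode-statistics : ∀ T → InT n k T →
    cdesT T ≡ des (encode T) × firstT T ≡ firstW (encode T) × lastT T ≡ lastW (encode T)
  encode-statistics (node _ ts) v@(refl , _ , _ , _ , ok) =
    forestWord-statistics ts (oddOKs⇒wellLabelled ts ok) (All.map proj₁ (InT-letters ts v))

theorem2p1 : (n : ℕ) → (k : ℕ → ℕ) → 1 ≤ n → (∀ i → 1 ≤ i → i ≤ n → 1 ≤ k i) →
    Σ (Tree → List ℕ) λ φ →
      (∀ T → InT n k T → InQ n k (φ T)) ×
      (∀ T T′ → InT n k T → InT n k T′ → φ T ≡ φ T′ → T ≡ T′) ×
      (∀ π → InQ n k π → Σ Tree λ T → InT n k T × φ T ≡ π) ×
      (∀ T → InT n k T →
        cdesT T ≡ des (φ T) × firstT T ≡ firstW (φ T) × lastT T ≡ lastW (φ T))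
theorem2p1 n k _ _ =
  encode ,
  encode-InQ ,
  encode-injective ,
  (λ π π∈Q → decode π , decode-InT π π∈Q , encode-decode π) ,
  encode-statistics
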